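{- Let $p,q$ be integers and let $(u_n)_{n\ge 0}$ be the Lucas sequence defined by $u_0=0$, $u_1=1$ and $u_{n+2}=p\,u_{n+1}+q\,u_n$ for all $n\ge 0$. Then $\mathcal{D}_{\bf u}(2^k)=2^k$ for all integers $k\ge 1$ if and only if $p\equiv 2\pmod 4$ and $q\equiv 3\pmod 4$.
   Context: For a sequence ${\bf u}=(u_n)_{n\ge 0}$ of integers and a positive integer $n$, the discriminator $\mathcal{D}_{\bf u}(n)$ is the smallest positive integer $m$ such that $u_0,\ldots,u_{n-1}$ are pairwise incongruent modulo $m$. -}

module Defs where

open import Data.Nat using (ℕ; zero; suc; _<_; _≤_)
open import Data.Integer using (ℤ; +_; _+_; _*_; _-_)
open import Data.Integer.Divisibility using (_∣_)
open import Relation.Binary.PropositionalEquality using (_≡_)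
open import Relation.Nullary using (¬_)
open import Data.Product using (_×_)

lucas : ℤ → ℤ → ℕ → ℤ
lucas p q zero = + 0
lucas p q (suc zero) = + 1
lucas p q (suc (suc n)) = p * lucas p q (suc n) + q * lucas p q n

_≡_[mod_] : ℤ → ℤ → ℕ → Set
a ≡ b [mod m ] = (+ m) ∣ (a - b)

PairwiseIncongruent : (ℕ → ℤ) → ℕ → ℕ → Set
PairwiseIncongruent u n m =
  ∀ i j → i < n → j < n → u i ≡ u j [mod m ] → i ≡ j

Discriminator : (ℕ → ℤ) → ℕ → ℕ → Set
Discriminator u n m =
  (1 ≤ m) × PairwiseIncongruent u n m
  × (∀ m′ → 1 ≤ m′ → m′ < m → ¬ PairwiseIncongruent u n m′)

-- Only the residues of p and q modulo 8 matter for the first eight terms modulo 8, so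
-- necessity is a finite check.  For sufficiency write p = 2 + 4r and q = 3 + 4s.  The
-- doubling formulas u(2T) = u(T) (2 u(T+1) - p u(T)) and u(2T+1) = u(T+1)² + q u(T)²
-- show by induction that for T = 2^k both u(T) and u(T+1) - 1 are T times an odd number.
-- As p is even and q odd, the differences u(n+T) - u(n) satisfy the same recurrence and
-- hence are all T times an odd number: u(n+T) ≡ u(n) + T (mod 2T).  So the two halves of
-- [0, 2T) agree modulo T but differ by T modulo 2T, which lets incongruence on [0, T)
-- modulo T double to [0, 2T) modulo 2T.  Minimality is the pigeonhole principle.
module Submission where

open import Defs
open import Data.Nat using (ℕ; zero; suc; z≤n; s≤s; _^_; _<_; _<?_; _≟_; NonZero; >-nonZero)
import Data.Nat as ℕ
open import Data.Nat.Properties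
  using (allUpTo?; <⇒≱; m<m*n; *-comm; ≮⇒≥; m∸n+n≡m; +-cancelʳ-<; +-identityʳ;
         n<1⇒n≡0; m^n>0; m^n≢0; module ≤-Reasoning)
open import Data.Integer using (ℤ; +_; -_; _+_; _-_; _*_; ∣_∣)
open import Function.Bundles using (_⇔_; mk⇔)
open import Data.Empty using (⊥-elim)
open import Data.Product using (_×_; _,_; proj₁; proj₂; map; ∃-syntax)
open import Data.Fin using (Fin; toℕ; fromℕ<)
open import Data.Fin.Properties using (pigeonhole; <-irrefl; toℕ-injective; toℕ<n; fromℕ<-injective)
open import Data.Nat.Divisibility using (_∣?_; n∣m*n; ∣⇒≤) renaming (_∣_ to _∣ℕ_)
import Data.Integer.Divisibility.Signed as Signed
open import Data.Integer.Divisibility.Signed using (divides)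
open import Data.Integer.DivMod using (_%ℕ_; _/ℕ_; a≡a%ℕn+[a/ℕn]*n; n%ℕd<d)
import Data.Integer.Properties as ℤ
open import Data.Integer.Tactic.RingSolver using (solve-∀)
open import Level using (0ℓ)
open import Relation.Binary.Bundles using (Setoid)
open import Relation.Binary.Structures using (IsEquivalence)
import Relation.Binary.Reasoning.Setoid as SetoidReasoning
open import Relation.Binary.PropositionalEquality
  using (_≡_; refl; sym; trans; cong; cong₂; subst; module ≡-Reasoning)
open import Relation.Nullary using (¬_; yes; no)
open import Relation.Nullary.Decidable using (Dec; _×-dec_; _→-dec_; toWitness; map′)

-- `_≡_[mod_]` unfolds to arithmetic on its arguments, so Agda cannot infer them from
-- a goal; this record around the signed form can be inferred.
record _≋_[mod_] (a b : ℤ) (m : ℕ) : Set where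
  constructor congruent
  field divides-difference : + m Signed.∣ a - b

open _≋_[mod_]

≡-mod⇒≋ : ∀ {m a b} → a ≡ b [mod m ] → a ≋ b [mod m ]
≡-mod⇒≋ h = congruent (Signed.∣ᵤ⇒∣ h)

≋⇒≡-mod : ∀ {m a b} → a ≋ b [mod m ] → a ≡ b [mod m ]
≋⇒≡-mod h = Signed.∣⇒∣ᵤ (divides-difference h)

≋-refl : ∀ {m a} → a ≋ a [mod m ]
≋-refl {m} {a} = congruent (divides (+ 0) (self-difference a))
  where
  self-difference : ∀ a → a - a ≡ + 0 * + m
  self-difference = solve-∀

≋-sym : ∀ {m a b} → a ≋ b [mod m ] → b ≋ a [mod m ]
≋-sym {a = a} {b} (congruent h) = congruent (subst (_ Signed.∣_) (negate a b) (Signed.∣m⇒∣-m h))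
  where
  negate : ∀ a b → - (a - b) ≡ b - a
  negate = solve-∀

≋-trans : ∀ {m a b c} → a ≋ b [mod m ] → b ≋ c [mod m ] → a ≋ c [mod m ]
≋-trans {a = a} {b} {c} (congruent h) (congruent h′) =
  congruent (subst (_ Signed.∣_) (chain a b c) (Signed.∣m∣n⇒∣m+n h h′))
  where
  chain : ∀ a b c → (a - b) + (b - c) ≡ a - c
  chain = solve-∀

≋-isEquivalence : ∀ m → IsEquivalence (_≋_[mod m ])
≋-isEquivalence m = record { refl = ≋-refl ; sym = ≋-sym ; trans = ≋-trans }

≋-setoid : ℕ → Setoid 0ℓ 0ℓ
≋-setoid m = record { isEquivalence = ≋-isEquivalence m }

module ≋-Reasoning (m : ℕ) = SetoidReasoning (≋-setoid m)

≋-+ : ∀ {m a b c d} → a ≋ b [mod m ] → c ≋ d [mod m ] → (a + c) ≋ (b + d) [mod m ]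
≋-+ {a = a} {b} {c} {d} (congruent h) (congruent h′) =
  congruent (subst (_ Signed.∣_) (split a b c d) (Signed.∣m∣n⇒∣m+n h h′))
  where
  split : ∀ a b c d → (a - b) + (c - d) ≡ (a + c) - (b + d)
  split = solve-∀

≋-* : ∀ {m a b c d} → a ≋ b [mod m ] → c ≋ d [mod m ] → (a * c) ≋ (b * d) [mod m ]
≋-* {a = a} {b} {c} {d} (congruent h) (congruent h′) =
  congruent (subst (_ Signed.∣_) (split a b c d)
    (Signed.∣m∣n⇒∣m+n (Signed.∣m⇒∣m*n c h) (Signed.∣n⇒∣m*n b h′)))
  where
  split : ∀ a b c d → (a - b) * c + b * (c - d) ≡ a * c - b * d
  split = solve-∀

≋-∣ : ∀ {d m a b} → d ∣ℕ m → a ≋ b [mod m ] → a ≋ b [mod d ]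
≋-∣ d∣m (congruent h) = congruent (Signed.∣-trans (Signed.∣ᵤ⇒∣ d∣m) h)

+-modulus-≋ : ∀ m a → (a + + m) ≋ a [mod m ]
+-modulus-≋ m a = congruent (divides (+ 1) (shift a (+ m)))
  where
  shift : ∀ a k → (a + k) - a ≡ + 1 * k
  shift = solve-∀

+-modulus-≉[mod-double] : ∀ {m} .{{_ : NonZero m}} a → ¬ ((a + + m) ≋ a [mod 2 ℕ.* m ])
+-modulus-≉[mod-double] {m} a a+m≋a = <⇒≱ (m<m*n m 2 (s≤s (s≤s z≤n))) (begin
  m ℕ.* 2   ≡⟨ *-comm m 2 ⟩
  2 ℕ.* m   ≤⟨ ∣⇒≤ 2m∣m ⟩
  m         ∎)
  where
  open ≤-Reasoning
  shift : ∀ a k → (a + k) - a ≡ k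
  shift = solve-∀
  2m∣m : 2 ℕ.* m ∣ℕ m
  2m∣m = subst (2 ℕ.* m ∣ℕ_) (cong ∣_∣ (shift a (+ m))) (≋⇒≡-mod a+m≋a)

≋-%ℕ : ∀ a m .{{_ : NonZero m}} → a ≋ + (a %ℕ m) [mod m ]
≋-%ℕ a m = congruent (divides (a /ℕ m)
  (trans (cong (_- r) (a≡a%ℕn+[a/ℕn]*n a m)) (cancel r (a /ℕ m) (+ m))))
  where
  r = + (a %ℕ m)
  cancel : ∀ r q m → (r + q * m) - r ≡ q * m
  cancel = solve-∀

≋⇒≡+multiple : ∀ {m a b} → a ≋ b [mod m ] → ∃[ k ] a ≡ b + k * + m
≋⇒≡+multiple {a = a} {b} (congruent (divides k a-b≡km)) =
  k , trans (add-back a b) (cong (λ d → b + d) a-b≡km)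
  where
  add-back : ∀ a b → a ≡ b + (a - b)
  add-back = solve-∀

lucas-≋ : ∀ {m p p′ q q′} → p ≋ p′ [mod m ] → q ≋ q′ [mod m ] →
          ∀ n → lucas p q n ≋ lucas p′ q′ n [mod m ]
lucas-≋ p≋p′ q≋q′ zero = ≋-refl
lucas-≋ p≋p′ q≋q′ (suc zero) = ≋-refl
lucas-≋ p≋p′ q≋q′ (suc (suc n)) =
  ≋-+ (≋-* p≋p′ (lucas-≋ p≋p′ q≋q′ (suc n))) (≋-* q≋q′ (lucas-≋ p≋p′ q≋q′ n))

lucas-+ : ∀ p q m n → lucas p q (suc (m ℕ.+ n)) ≡
          lucas p q (suc m) * lucas p q (suc n) + q * lucas p q m * lucas p q n
lucas-+ p q zero n = unit (lucas p q (suc n)) q (lucas p q n)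
  where
  unit : ∀ a q b → a ≡ + 1 * a + q * + 0 * b
  unit = solve-∀
lucas-+ p q (suc zero) n = unit p q (lucas p q (suc n)) (lucas p q n)
  where
  unit : ∀ p q a b → p * a + q * b ≡ (p * + 1 + q * + 0) * a + q * + 1 * b
  unit = solve-∀
lucas-+ p q (suc (suc m)) n = begin
  p * u (suc (suc m ℕ.+ n)) + q * u (suc (m ℕ.+ n))
    ≡⟨ cong₂ (λ a b → p * a + q * b) (lucas-+ p q (suc m) n) (lucas-+ p q m n) ⟩
  p * (u (suc (suc m)) * u (suc n) + q * u (suc m) * u n) + q * (u (suc m) * u (suc n) + q * u m * u n)
    ≡⟨ regroup p q (u (suc (suc m))) (u (suc m)) (u m) (u (suc n)) (u n) ⟩
  (p * u (suc (suc m)) + q * u (suc m)) * u (suc n) + q * (p * u (suc m) + q * u m) * u n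
    ∎
  where
  open ≡-Reasoning
  u = lucas p q
  regroup : ∀ p q a b c x y → p * (a * x + q * b * y) + q * (b * x + q * c * y) ≡
                              (p * a + q * b) * x + q * (p * b + q * c) * y
  regroup = solve-∀

lucas-double : ∀ p q n → lucas p q (suc n ℕ.+ suc n) ≡
               lucas p q (suc n) * (+ 2 * lucas p q (suc (suc n)) - p * lucas p q (suc n))
lucas-double p q n = trans (lucas-+ p q n (suc n)) (eliminate p q (lucas p q (suc n)) (lucas p q n))
  where
  eliminate : ∀ p q a b → a * (p * a + q * b) + q * b * a ≡ a * (+ 2 * (p * a + q * b) - p * a)
  eliminate = solve-∀

pairwiseIncongruent-resp : ∀ {u v m} → (∀ i → u i ≋ v i [mod m ]) →
                           ∀ {n} → PairwiseIncongruent v n m → PairwiseIncongruent u n m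
pairwiseIncongruent-resp {u} {v} {m} u≋v incongruent i j i<n j<n ui≡uj =
  incongruent i j i<n j<n (≋⇒≡-mod (begin
    v i ≈⟨ u≋v i ⟨
    u i ≈⟨ ≡-mod⇒≋ ui≡uj ⟩
    u j ≈⟨ u≋v j ⟩
    v j ∎))
  where open ≋-Reasoning m

m<n⇒¬pairwiseIncongruent : ∀ {u n m} .{{_ : NonZero m}} → m < n → ¬ PairwiseIncongruent u n m
m<n⇒¬pairwiseIncongruent {u} {n} {m} m<n incongruent =
  let i , j , i<j , same-residue = pigeonhole m<n residue
  in <-irrefl (toℕ-injective (incongruent _ _ (toℕ<n i) (toℕ<n j) (≋⇒≡-mod (begin
       u (toℕ i)            ≈⟨ ≋-%ℕ (u (toℕ i)) m ⟩
       + (u (toℕ i) %ℕ m)   ≡⟨ cong +_ (fromℕ<-injective _ _ (residue< i) (residue< j) same-residue) ⟩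
       + (u (toℕ j) %ℕ m)   ≈⟨ ≋-%ℕ (u (toℕ j)) m ⟨
       u (toℕ j)            ∎)))) i<j
  where
  open ≋-Reasoning m
  residue< : ∀ i → u (toℕ i) %ℕ m < m
  residue< i = n%ℕd<d (u (toℕ i)) m
  residue : Fin n → Fin m
  residue i = fromℕ< (residue< i)

data Half (T : ℕ) : ℕ → Set where
  lower : ∀ {i} → i < T → Half T i
  upper : ∀ {i} → i < T → Half T (i ℕ.+ T)

half : ∀ T {i} → i < 2 ℕ.* T → Half T i
half T {i} i<2T with i <? T
... | yes i<T = lower i<T
... | no i≮T = subst (Half T) (m∸n+n≡m T≤i) (upper (+-cancelʳ-< T (i ℕ.∸ T) T (begin-strict
  i ℕ.∸ T ℕ.+ T  ≡⟨ m∸n+n≡m T≤i ⟩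
  i              <⟨ i<2T ⟩
  2 ℕ.* T        ≡⟨ cong (T ℕ.+_) (+-identityʳ T) ⟩
  T ℕ.+ T        ∎)))
  where
  open ≤-Reasoning
  T≤i = ≮⇒≥ i≮T

module _ {u : ℕ → ℤ} {T : ℕ} .{{_ : NonZero T}}
         (shift : ∀ n → u (n ℕ.+ T) ≋ u n + + T [mod 2 ℕ.* T ])
         (incongruent : PairwiseIncongruent u T T) where

  private
    halve : ∀ {a b} → a ≋ b [mod 2 ℕ.* T ] → a ≋ b [mod T ]
    halve = ≋-∣ (n∣m*n 2)

    periodic : ∀ n → u (n ℕ.+ T) ≋ u n [mod T ]
    periodic n = ≋-trans (halve (shift n)) (+-modulus-≋ T (u n))

    incongruent-≋ : ∀ {i j} → i < T → j < T → u i ≋ u j [mod T ] → i ≡ j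
    incongruent-≋ i<T j<T ui≋uj = incongruent _ _ i<T j<T (≋⇒≡-mod ui≋uj)

    upper≉lower : ∀ {i j} → i < T → j < T → ¬ (u (i ℕ.+ T) ≋ u j [mod 2 ℕ.* T ])
    upper≉lower {i} {j} i<T j<T ui+T≋uj = +-modulus-≉[mod-double] (u i) (begin
      u i + + T     ≈⟨ shift i ⟨
      u (i ℕ.+ T)   ≈⟨ ui+T≋uj ⟩
      u j           ≡⟨ cong u i≡j ⟨
      u i           ∎)
      where
      open ≋-Reasoning (2 ℕ.* T)
      i≡j : i ≡ j
      i≡j = incongruent-≋ i<T j<T (≋-trans (≋-sym (periodic i)) (halve ui+T≋uj))

  incongruent-double : PairwiseIncongruent u (2 ℕ.* T) (2 ℕ.* T)
  incongruent-double i j i<2T j<2T ui≡uj = by-halves (half T i<2T) (half T j<2T) (≡-mod⇒≋ ui≡uj)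
    where
    by-halves : ∀ {i j} → Half T i → Half T j → u i ≋ u j [mod 2 ℕ.* T ] → i ≡ j
    by-halves (lower i<T) (lower j<T) ui≋uj = incongruent-≋ i<T j<T (halve ui≋uj)
    by-halves (lower i<T) (upper j<T) ui≋uj = ⊥-elim (upper≉lower j<T i<T (≋-sym ui≋uj))
    by-halves (upper i<T) (lower j<T) ui≋uj = ⊥-elim (upper≉lower i<T j<T ui≋uj)
    by-halves (upper {i} i<T) (upper {j} j<T) ui≋uj = cong (ℕ._+ T) (incongruent-≋ i<T j<T (begin
      u i             ≈⟨ periodic i ⟨
      u (i ℕ.+ T)     ≈⟨ halve ui≋uj ⟩
      u (j ℕ.+ T)     ≈⟨ periodic j ⟩
      u j             ∎))
      where open ≋-Reasoning T

OddMultiple : ℤ → ℤ → Set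
OddMultiple d a = ∃[ x ] a ≡ d * (+ 1 + + 2 * x)

oddMultiple⇒≋ : ∀ {d} a b → OddMultiple (+ d) (a - b) → a ≋ (b + + d) [mod 2 ℕ.* d ]
oddMultiple⇒≋ {d} a b (x , a-b≡d[1+2x]) = congruent (divides x (begin
  a - (b + + d)              ≡⟨ regroup a b (+ d) ⟩
  (a - b) - + d              ≡⟨ cong (_- + d) a-b≡d[1+2x] ⟩
  + d * (+ 1 + + 2 * x) - + d ≡⟨ expand (+ d) x ⟩
  x * (+ 2 * + d)            ≡⟨ cong (x *_) (ℤ.pos-* 2 d) ⟨
  x * + (2 ℕ.* d)            ∎))
  where
  open ≡-Reasoning
  regroup : ∀ a b d → a - (b + d) ≡ (a - b) - d
  regroup = solve-∀
  expand : ∀ d x → d * (+ 1 + + 2 * x) - d ≡ x * (+ 2 * d)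
  expand = solve-∀

oddMultiple-recurrence : ∀ {d} p′ q′ (w : ℕ → ℤ) →
  (∀ n → w (suc (suc n)) ≡ + 2 * p′ * w (suc n) + (+ 1 + + 2 * q′) * w n) →
  OddMultiple d (w 0) → OddMultiple d (w 1) → ∀ n → OddMultiple d (w n)
oddMultiple-recurrence {d} p′ q′ w recurrence w₀ w₁ n = proj₁ (consecutive n)
  where
  consecutive : ∀ n → OddMultiple d (w n) × OddMultiple d (w (suc n))
  consecutive zero = w₀ , w₁
  consecutive (suc n) with consecutive n
  ... | (x , wn) , (y , wn+1) = (y , wn+1) , (p′ * (+ 1 + + 2 * y) + x + q′ + + 2 * q′ * x , (begin
    w (suc (suc n))
      ≡⟨ recurrence n ⟩
    + 2 * p′ * w (suc n) + (+ 1 + + 2 * q′) * w n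
      ≡⟨ cong₂ (λ a b → + 2 * p′ * a + (+ 1 + + 2 * q′) * b) wn+1 wn ⟩
    + 2 * p′ * (d * (+ 1 + + 2 * y)) + (+ 1 + + 2 * q′) * (d * (+ 1 + + 2 * x))
      ≡⟨ even+odd d p′ q′ x y ⟩
    d * (+ 1 + + 2 * (p′ * (+ 1 + + 2 * y) + x + q′ + + 2 * q′ * x)) ∎))
    where
    open ≡-Reasoning
    even+odd : ∀ d p′ q′ x y →
      + 2 * p′ * (d * (+ 1 + + 2 * y)) + (+ 1 + + 2 * q′) * (d * (+ 1 + + 2 * x)) ≡
      d * (+ 1 + + 2 * (p′ * (+ 1 + + 2 * y) + x + q′ + + 2 * q′ * x))
    even+odd = solve-∀

_≡?_[mod_] : ∀ a b m → Dec (a ≡ b [mod m ])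
a ≡? b [mod m ] = m ∣? ∣ a - b ∣

pairwiseIncongruent? : ∀ u n m → Dec (PairwiseIncongruent u n m)
pairwiseIncongruent? u n m = map′ (λ h i j i<n → h i<n {j}) (λ h {i} i<n {j} → h i j i<n)
  (allUpTo? (λ i → allUpTo? (λ j → (u i ≡? u j [mod m ]) →-dec (i ≟ j)) n) n)

residue-criterion : ∀ {r} → r < 8 → ∀ {s} → s < 8 →
                    PairwiseIncongruent (lucas (+ r) (+ s)) 8 8 →
                    ((+ r) ≡ + 2 [mod 4 ]) × ((+ s) ≡ + 3 [mod 4 ])
residue-criterion = toWitness {a? = allUpTo? (λ r → allUpTo? (λ s →
  pairwiseIncongruent? (lucas (+ r) (+ s)) 8 8
    →-dec (((+ r) ≡? + 2 [mod 4 ]) ×-dec ((+ s) ≡? + 3 [mod 4 ]))) 8) 8} _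

coefficients-mod-4 : ∀ p q → PairwiseIncongruent (lucas p q) 8 8 →
                     (p ≡ + 2 [mod 4 ]) × (q ≡ + 3 [mod 4 ])
coefficients-mod-4 p q incongruent =
  map (lift p) (lift q) (residue-criterion (n%ℕd<d p 8) (n%ℕd<d q 8)
    (pairwiseIncongruent-resp (lucas-≋ (≋-sym (≋-%ℕ p 8)) (≋-sym (≋-%ℕ q 8))) incongruent))
  where
  lift : ∀ a {b} → (+ (a %ℕ 8)) ≡ b [mod 4 ] → a ≡ b [mod 4 ]
  lift a a%8≡b = ≋⇒≡-mod (≋-trans (≋-∣ (n∣m*n 2) (≋-%ℕ a 8)) (≡-mod⇒≋ a%8≡b))

module PowersOfTwo (r s : ℤ) where

  p q : ℤ
  p = + 2 + r * + 4
  q = + 3 + s * + 4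

  u : ℕ → ℤ
  u = lucas p q

  OddMultiplesAt : ℕ → Set
  OddMultiplesAt T = OddMultiple (+ T) (u T) × OddMultiple (+ T) (u (suc T) - + 1)

  oddMultiplesAt-double : ∀ {T} → 0 < T → OddMultiplesAt T → OddMultiplesAt (2 ℕ.* T)
  oddMultiplesAt-double {T@(suc t)} _ ((x , uT≡) , (y , uT+1-1≡)) =
    subst OddMultiplesAt (sym (cong (T ℕ.+_) (+-identityʳ T))) (even , odd)
    where
    open ≡-Reasoning
    P = + T
    -- The witnesses come from (1 + 2y) - (1 + 2r) (1 + 2x) = 2 (y - x - r - 2rx)
    -- and (1 + 2y)² + q (1 + 2x)² = 4 V.
    uT+1≡ : u (suc T) ≡ + 1 + P * (+ 1 + + 2 * y)
    uT+1≡ = trans (add-back (u (suc T))) (cong (λ a → + 1 + a) uT+1-1≡)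
      where
      add-back : ∀ a → a ≡ + 1 + (a - + 1)
      add-back = solve-∀
    even : OddMultiple (P + P) (u (T ℕ.+ T))
    even = x + P * (y - x - r - + 2 * r * x) * (+ 1 + + 2 * x) , (begin
      u (T ℕ.+ T)
        ≡⟨ lucas-double p q t ⟩
      u T * (+ 2 * u (suc T) - p * u T)
        ≡⟨ cong₂ (λ a b → a * (+ 2 * b - p * a)) uT≡ uT+1≡ ⟩
      P * (+ 1 + + 2 * x) * (+ 2 * (+ 1 + P * (+ 1 + + 2 * y)) - p * (P * (+ 1 + + 2 * x)))
        ≡⟨ identity P x y r ⟩
      (P + P) * (+ 1 + + 2 * (x + P * (y - x - r - + 2 * r * x) * (+ 1 + + 2 * x))) ∎)
      where
      identity : ∀ P x y r →
        P * (+ 1 + + 2 * x) * (+ 2 * (+ 1 + P * (+ 1 + + 2 * y))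
          - (+ 2 + r * + 4) * (P * (+ 1 + + 2 * x))) ≡
        (P + P) * (+ 1 + + 2 * (x + P * (y - x - r - + 2 * r * x) * (+ 1 + + 2 * x)))
      identity = solve-∀
    odd : OddMultiple (P + P) (u (suc (T ℕ.+ T)) - + 1)
    odd = y + P * V , (begin
      u (suc (T ℕ.+ T)) - + 1
        ≡⟨ cong (_- + 1) (lucas-+ p q T T) ⟩
      u (suc T) * u (suc T) + q * u T * u T - + 1
        ≡⟨ cong₂ (λ a b → b * b + q * a * a - + 1) uT≡ uT+1≡ ⟩
      (+ 1 + P * (+ 1 + + 2 * y)) * (+ 1 + P * (+ 1 + + 2 * y))
        + q * (P * (+ 1 + + 2 * x)) * (P * (+ 1 + + 2 * x)) - + 1
        ≡⟨ identity P x y s ⟩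
      (P + P) * (+ 1 + + 2 * (y + P * V)) ∎)
      where
      V = + 1 + y + y * y + + 3 * x + + 3 * x * x + s * (+ 1 + + 2 * x) * (+ 1 + + 2 * x)
      identity : ∀ P x y s →
        (+ 1 + P * (+ 1 + + 2 * y)) * (+ 1 + P * (+ 1 + + 2 * y))
          + (+ 3 + s * + 4) * (P * (+ 1 + + 2 * x)) * (P * (+ 1 + + 2 * x)) - + 1 ≡
        (P + P) * (+ 1 + + 2 * (y + P * (+ 1 + y + y * y + + 3 * x + + 3 * x * x
                                           + s * (+ 1 + + 2 * x) * (+ 1 + + 2 * x))))
      identity = solve-∀

  oddMultiplesAt : ∀ k → OddMultiplesAt (2 ^ k)
  oddMultiplesAt zero = (+ 0 , refl) , (r * + 2 , base r s)
    where
    base : ∀ r s → (+ 2 + r * + 4) * + 1 + (+ 3 + s * + 4) * + 0 - + 1 ≡ + 1 * (+ 1 + + 2 * (r * + 2))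
    base = solve-∀
  oddMultiplesAt (suc k) = oddMultiplesAt-double (m^n>0 2 k) (oddMultiplesAt k)

  shift : ∀ k n → u (n ℕ.+ 2 ^ k) ≋ u n + + (2 ^ k) [mod 2 ^ suc k ]
  shift k n = oddMultiple⇒≋ (u (n ℕ.+ T)) (u n)
    (oddMultiple-recurrence {+ T} (+ 1 + r * + 2) (+ 1 + s * + 2) w recurrence w₀ w₁ n)
    where
    T = 2 ^ k
    w : ℕ → ℤ
    w n = u (n ℕ.+ T) - u n
    recurrence : ∀ n → w (suc (suc n)) ≡
                       + 2 * (+ 1 + r * + 2) * w (suc n) + (+ 1 + + 2 * (+ 1 + s * + 2)) * w n
    recurrence n = difference r s (u (suc (n ℕ.+ T))) (u (n ℕ.+ T)) (u (suc n)) (u n)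
      where
      difference : ∀ r s a b c d →
        ((+ 2 + r * + 4) * a + (+ 3 + s * + 4) * b) - ((+ 2 + r * + 4) * c + (+ 3 + s * + 4) * d) ≡
        + 2 * (+ 1 + r * + 2) * (a - c) + (+ 1 + + 2 * (+ 1 + s * + 2)) * (b - d)
      difference = solve-∀
    w₀ : OddMultiple (+ T) (w 0)
    w₀ = let x , uT≡ = proj₁ (oddMultiplesAt k) in x , trans (ℤ.+-identityʳ (u T)) uT≡
    w₁ : OddMultiple (+ T) (w 1)
    w₁ = proj₂ (oddMultiplesAt k)

  incongruent : ∀ k → PairwiseIncongruent u (2 ^ k) (2 ^ k)
  incongruent zero i j i<1 j<1 _ = trans (n<1⇒n≡0 i<1) (sym (n<1⇒n≡0 j<1))
  incongruent (suc k) = incongruent-double {u} {{m^n≢0 2 k}} (shift k) (incongruent k)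

  discriminator : ∀ k → Discriminator u (2 ^ k) (2 ^ k)
  discriminator k = m^n>0 2 k , incongruent k ,
    λ m m>0 m<2^k → m<n⇒¬pairwiseIncongruent {u} {{>-nonZero m>0}} m<2^k

discriminator-powers : ∀ {p q} → p ≡ + 2 [mod 4 ] → q ≡ + 3 [mod 4 ] →
                       ∀ k → Discriminator (lucas p q) (2 ^ k) (2 ^ k)
discriminator-powers {p} {q} p≡2 q≡3
  with r , refl ← ≋⇒≡+multiple (≡-mod⇒≋ {a = p} {+ 2} p≡2)
     | s , refl ← ≋⇒≡+multiple (≡-mod⇒≋ {a = q} {+ 3} q≡3)
  = PowersOfTwo.discriminator r s

theorem5 : (p q : ℤ) →
    ((k : ℕ) → Discriminator (lucas p q) (2 ^ suc k) (2 ^ suc k))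
    ⇔ ((p ≡ + 2 [mod 4 ]) × (q ≡ + 3 [mod 4 ]))
theorem5 p q = mk⇔
  (λ discriminates → coefficients-mod-4 p q (proj₁ (proj₂ (discriminates 2))))
  (λ (p≡2 , q≡3) k → discriminator-powers p≡2 q≡3 (suc k))
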